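{- Let $(\mathcal W,\mathcal T_\#)$, derived from $(W,\#,\preccurlyeq)$, be a subspraid of a spraid $(\mathcal V,\mathcal T_\#)$ derived from $(V,\#,\preccurlyeq)$. Let $a\in W$ and let $B$ be a genetic bar on $V_a$. Then $B$ contains a genetic bar on the basic subspraid $W_a$ of $(\mathcal W,\mathcal T_\#)$.
   Context: Setting: Bishop-style constructive mathematics with the induction principle for genetic bars. Pre-natural space $(V,\#,\preccurlyeq)$: $V$ countable, $\#,\preccurlyeq$ decidable, $\#$ symmetric irreflexive, $\preccurlyeq$ partial order, $a\preccurlyeq b\wedge c\#b\Rightarrow c\#a$; $a\prec b$ means $a\preccurlyeq b,a\ne b$; a maximal dot exists. Points: sequences $(p_n)$ with $p_{n+1}\preccurlyeq p_n$, for each $n$ some $m$ with $p_m\prec p_n$, and for every $c\#d$ some $m$ with $p_m\#c$ or $p_m\#d$; apartness topology: $U$ open iff for every $x\in U$ and point $y$ one can determine $y\#x$ or that all points passing strictly below $y_m$ lie in $U$, for some $m$. In a poset $X$ with maximal element, $a$ is an immediate successor of $c$ in $X$ if $a\prec c$ and no $b\in X$ has $a\prec b\prec c$; $\mathrm{suc}(c)$ denotes these. Trea: each element has finitely many elements above it and all immediate-successor chains from the maximal element to $a$ have a common length. Spraid: a natural space (maximal dot, every dot contains a point) whose dots form a trea and in which every infinite strictly decreasing sequence of dots is a point. $(\mathcal W,\mathcal T_\#)$ is a subspraid of $(\mathcal V,\mathcal T_\#)$ if $W\subseteq V$ is decidable, $(W,\#,\preccurlyeq)$ (restricted relations, with its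 own maximal dot) yields a spraid whose apartness topology coincides with the subspace topology from $\mathcal V$, and every immediate successor relation in $W$ is an immediate successor relation in $V$. For $a$, $V_a=\{b\in V:b\preccurlyeq a\}$ and $W_a=\{b\in W:b\preccurlyeq a\}$, each with maximal dot $a$. Genetic bars on $V_a$: $\{a\}$ is one; if $B_b$ is a genetic bar on $V_b$ for every $b\in\mathrm{suc}(a)$ (successors in $V$), then $\bigcup_b B_b$ is a genetic bar on $V_a$; only sets so generated (analogously in $W$). -}

module Defs where

open import Level using (0ℓ)
open import Data.Nat using (ℕ; zero; suc)
open import Data.Bool using (Bool; T)
open import Data.Product using (Σ; ∃; ∃-syntax; _×_; _,_; proj₁)
open import Data.Sum using (_⊎_)
open import Data.List using (List)
open import Data.List.Membership.Propositional using (_∈_)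
open import Relation.Nullary using (¬_)
open import Relation.Unary using (Pred)
open import Relation.Binary using (Rel; Decidable)
open import Relation.Binary.PropositionalEquality using (_≡_; _≢_)
open import Function.Bundles using (_⇔_)

-- Raw data (V, #, ≼) together with a designated maximal dot.

record Structure : Set₁ where
  field
    Dot  : Set
    _#_  : Rel Dot 0ℓ
    _≼_  : Rel Dot 0ℓ
    top  : Dot

module Notions (S : Structure) where
  open Structure S

  _≺_ : Rel Dot 0ℓ
  a ≺ b = (a ≼ b) × (a ≢ b)

  ImmSuc : Dot → Dot → Set
  ImmSuc a c = (a ≺ c) × ¬ (Σ Dot λ b → (a ≺ b) × (b ≺ c))

  record IsPoint (p : ℕ → Dot) : Set where
    field
      decr    : ∀ n → p (suc n) ≼ p n
      shrinks : ∀ n → Σ ℕ λ m → p m ≺ p n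
      apart   : ∀ c d → c # d → Σ ℕ λ m → (p m # c) ⊎ (p m # d)

  _#ₚ_ : Rel (ℕ → Dot) 0ℓ
  x #ₚ y = Σ ℕ λ n → x n # y n

  PassesBelow : (ℕ → Dot) → Dot → Set
  PassesBelow z c = Σ ℕ λ n → z n ≺ c

  -- open sets of the apartness topology (subsets of points, given as
  -- predicates on sequences of dots; only their values on points matter)
  IsOpen : Pred (ℕ → Dot) 0ℓ → Set
  IsOpen U = ∀ x → IsPoint x → U x → ∀ y → IsPoint y →
               (y #ₚ x) ⊎
               (Σ ℕ λ m → ∀ z → IsPoint z → PassesBelow z (y m) → U z)

  data Chain (c : Dot) : Dot → ℕ → Set where
    here : Chain c c zero
    step : ∀ {b a k} → Chain c b k → ImmSuc a b → Chain c a (suc k)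

  -- genetic bars on V_a  (bars are subsets of V)
  data GeneticBar : Dot → Pred Dot 0ℓ → Set₁ where
    single : ∀ {a B} → (∀ x → B x ⇔ (x ≡ a)) → GeneticBar a B
    union  : ∀ {a B} (F : (b : Dot) → ImmSuc b a → Pred Dot 0ℓ) →
             (∀ b (s : ImmSuc b a) → GeneticBar b (F b s)) →
             (∀ x → B x ⇔ (Σ Dot λ b → Σ (ImmSuc b a) λ s → F b s x)) →
             GeneticBar a B

  Countable : Set
  Countable = Σ (ℕ → Dot) λ e → ∀ d → Σ ℕ λ n → e n ≡ d

  record IsPreNatural : Set where
    field
      countable : Countable
      #-dec     : Decidable _#_
      ≼-dec     : Decidable _≼_
      #-sym     : ∀ {a b} → a # b → b # a
      #-irrefl  : ∀ a → ¬ (a # a)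
      ≼-refl    : ∀ a → a ≼ a
      ≼-trans   : ∀ {a b c} → a ≼ b → b ≼ c → a ≼ c
      ≼-antisym : ∀ {a b} → a ≼ b → b ≼ a → a ≡ b
      #-mono    : ∀ {a b c} → a ≼ b → c # b → c # a
      top-max   : ∀ a → a ≼ top

  PassesThrough : (ℕ → Dot) → Dot → Set
  PassesThrough p a = Σ ℕ λ n → p n ≼ a

  record IsNatural : Set where
    field
      preNatural    : IsPreNatural
      dot-has-point : ∀ a → Σ (ℕ → Dot) λ p → IsPoint p × PassesThrough p a

  record IsTrea : Set where
    field
      finite-above : ∀ a → Σ (List Dot) λ l → ∀ b → (a ≼ b) ⇔ (b ∈ l)
      chain-length : ∀ a k k' → Chain top a k → Chain top a k' → k ≡ k'

  record IsSpraid : Set where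
    field
      natural : IsNatural
      trea    : IsTrea
      decr-is-point : ∀ p → (∀ n → p (suc n) ≺ p n) → IsPoint p

Restrict : (S : Structure) (inW : Structure.Dot S → Bool) →
           Σ (Structure.Dot S) (λ v → T (inW v)) → Structure
Restrict S inW tW = record
  { Dot = Σ Dot (λ v → T (inW v))
  ; _#_ = λ x y → proj₁ x # proj₁ y
  ; _≼_ = λ x y → proj₁ x ≼ proj₁ y
  ; top = tW
  }
  where open Structure S

record IsSubspraid (S : Structure) (inW : Structure.Dot S → Bool)
                   (tW : Σ (Structure.Dot S) (λ v → T (inW v))) : Set₁ where
  private
    Sw = Restrict S inW tW
    module V = Notions S
    module W = Notions Sw
  field
    spraid : W.IsSpraid
    -- apartness topology of W coincides with the subspace topology
    topology : ∀ (U : Pred (ℕ → Structure.Dot Sw) 0ℓ) →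
      W.IsOpen U ⇔
      (Σ (Pred (ℕ → Structure.Dot S) 0ℓ) λ O → V.IsOpen O ×
         (∀ p → W.IsPoint p → U p ⇔ O (λ n → proj₁ (p n))))
    immSuc : ∀ a c → W.ImmSuc a c → V.ImmSuc (proj₁ a) (proj₁ c)

-- If B is the union of bars B_b over the successors b of a in
-- V, then every successor of a in W is one of these b (immediate successors in
-- W are immediate successors in V), so the union of the W-bars inside the
-- corresponding B_b is a genetic bar on W_a contained in B.
module Submission where

open import Defs
open import Level using (0ℓ)
open import Data.Bool using (Bool; T)
open import Data.Product using (Σ; _×_; _,_; proj₁; proj₂)
open import Relation.Unary using (Pred)
open import Relation.Binary.PropositionalEquality using (_≡_; cong)
open import Function using (id)
open import Function.Bundles using (mk⇔; Equivalence)

module _ {S S′ : Structure} (f : Structure.Dot S′ → Structure.Dot S)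
         (f-immSuc : ∀ a c → Notions.ImmSuc S′ a c →
                       Notions.ImmSuc S (f a) (f c)) where
  private
    module V = Notions S
    module W = Notions S′

  geneticBar-pullback : ∀ a (B : Pred (Structure.Dot S) 0ℓ) →
    V.GeneticBar (f a) B →
    Σ (Pred (Structure.Dot S′) 0ℓ) λ C →
      W.GeneticBar a C × (∀ w → C w → B (f w))
  geneticBar-pullback a B (V.single B≡a) =
    (_≡ a) , W.single (λ _ → mk⇔ id id) ,
    λ w w≡a → Equivalence.from (B≡a (f w)) (cong f w≡a)
  geneticBar-pullback a B (V.union F F-bar B≡⋃F) =
    C , W.union Cₛ Cₛ-bar (λ _ → mk⇔ id id) , C⊆B
    where
      pullback : ∀ b (s : W.ImmSuc b a) →
        Σ (Pred (Structure.Dot S′) 0ℓ) λ C →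
          W.GeneticBar b C × (∀ w → C w → F (f b) (f-immSuc b a s) (f w))
      pullback b s = geneticBar-pullback b (F (f b) (f-immSuc b a s))
                                           (F-bar (f b) (f-immSuc b a s))

      Cₛ : ∀ b → W.ImmSuc b a → Pred (Structure.Dot S′) 0ℓ
      Cₛ b s = proj₁ (pullback b s)

      Cₛ-bar : ∀ b (s : W.ImmSuc b a) → W.GeneticBar b (Cₛ b s)
      Cₛ-bar b s = proj₁ (proj₂ (pullback b s))

      C : Pred (Structure.Dot S′) 0ℓ
      C w = Σ (Structure.Dot S′) λ b → Σ (W.ImmSuc b a) λ s → Cₛ b s w

      C⊆B : ∀ w → C w → B (f w)
      C⊆B w (b , s , w∈Cₛ) = Equivalence.from (B≡⋃F (f w))
        (f b , f-immSuc b a s , proj₂ (proj₂ (pullback b s)) w w∈Cₛ)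

mainTheorem13 : (S : Structure) → Notions.IsSpraid S →
    (inW : Structure.Dot S → Bool) →
    (tW : Σ (Structure.Dot S) (λ v → T (inW v))) →
    IsSubspraid S inW tW →
    (a : Structure.Dot S) (aW : T (inW a)) →
    (B : Pred (Structure.Dot S) 0ℓ) →
    Notions.GeneticBar S a B →
    Σ (Pred (Σ (Structure.Dot S) (λ v → T (inW v))) 0ℓ) λ C →
    Notions.GeneticBar (Restrict S inW tW) (a , aW) C ×
    (∀ w → C w → B (proj₁ w))
mainTheorem13 S _ inW tW W⊆V a aW =
  geneticBar-pullback proj₁ (IsSubspraid.immSuc W⊆V) (a , aW)
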